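{- Suppose that $k \ge 3$, $m=(m_1,\ldots,m_{\frac{4^k-1}{3}}) \in \mathbb{Z}_{\ge 0}^{\frac{4^k-1}{3}}$ and $\sum_{i} m_i=n$. If the quaternary $[n,k]$ code $C_{k}(m)$ has minimum weight at least $\alpha$, then \[ 4\alpha-3n \le m_i \le n-\frac{4^{k-1}-1}{3\cdot 4^{k-2}}\alpha \] for any $i \in \{1,\ldots,\frac{4^k-1}{3}\}$.
   Context: $\mathbb{F}_4=\{0,1,\omega,\omega^2\}$ with $\omega^2=\omega+1$; $\mathbb{Z}_{\ge 0}$ is the set of nonnegative integers; $\mathbf{0}_s$ and $\mathbf{1}_s$ denote the zero vector and all-one vector of length $s$. The $k \times \frac{4^k-1}{3}$ matrices $S_k$ are defined inductively by $S_1=(1)$ and, for $k\ge 2$, \[ S_{k}= \begin{pmatrix} S_{k-1} & \mathbf{0}_{\frac{4^{k-1}-1}{3}}^T & S_{k-1} & S_{k-1} & S_{k-1}\\ \mathbf{0}_{\frac{4^{k-1}-1}{3}} & 1 & \mathbf{1}_{\frac{4^{k-1}-1}{3}} & \omega\mathbf{1}_{\frac{4^{k-1}-1}{3}} & \omega^2\mathbf{1}_{\frac{4^{k-1}-1}{3}} \end{pmatrix}; \] $S_k$ generates the quaternary simplex $[\frac{4^k-1}{3},k,4^{k-1}]$ code. Let $h_k^{(i)}$ be the $i$-th column of $S_k$. For $m=(m_1,\ldots,m_{\frac{4^k-1}{3}})\in\mathbb{Z}_{\ge 0}^{\frac{4^k-1}{3}}$ with $\sum_i m_i=n$, $G_k(m)$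 is the $k\times n$ matrix consisting of $m_1$ copies of the column $h_k^{(1)}$, followed by $m_2$ copies of $h_k^{(2)}$, ..., followed by $m_{\frac{4^k-1}{3}}$ copies of $h_k^{(\frac{4^k-1}{3})}$, and $C_k(m)$ denotes the quaternary code with generator matrix $G_k(m)$. -}

module Defs where

open import Data.Nat using (ℕ; zero; suc; _+_; _*_)
open import Data.Vec using (Vec; []; _∷_; _∷ʳ_; _++_; map; replicate; toList; foldr)
open import Data.List as List using (List)
open import Relation.Binary.PropositionalEquality using (_≡_)
open import Relation.Nullary using (¬_)

data F4 : Set where
  𝟎 𝟏 ω ω² : F4

infixl 6 _⊕_
infixl 7 _⊗_

_⊕_ : F4 → F4 → F4
𝟎  ⊕ y  = y
x  ⊕ 𝟎  = x
𝟏  ⊕ 𝟏  = 𝟎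
𝟏  ⊕ ω  = ω²
𝟏  ⊕ ω² = ω
ω  ⊕ 𝟏  = ω²
ω  ⊕ ω  = 𝟎
ω  ⊕ ω² = 𝟏
ω² ⊕ 𝟏  = ω
ω² ⊕ ω  = 𝟏
ω² ⊕ ω² = 𝟎

_⊗_ : F4 → F4 → F4
𝟎  ⊗ y  = 𝟎
x  ⊗ 𝟎  = 𝟎
𝟏  ⊗ y  = y
x  ⊗ 𝟏  = x
ω  ⊗ ω  = ω²
ω  ⊗ ω² = 𝟏
ω² ⊗ ω  = 𝟏
ω² ⊗ ω² = ω

-- N k = (4^k - 1)/3, via N 0 = 0, N (k+1) = 4 N k + 1 (arranged to match the
-- block structure of S_{k+1}).
N : ℕ → ℕ
N zero    = zero
N (suc k) = N k + (1 + (N k + (N k + N k)))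

-- Columns of S_k, in order h_k^(1), ..., h_k^(N k).
-- S_0 is the empty 0×0 matrix; the recursion then gives S_1 = (1) and the
-- paper's recursion for k ≥ 2 (new row appended at the bottom).
S : (k : ℕ) → Vec (Vec F4 k) (N k)
S zero    = []
S (suc k) =
  map (_∷ʳ 𝟎) (S k) ++
  ((replicate k 𝟎 ∷ʳ 𝟏) ∷
   (map (_∷ʳ 𝟏) (S k) ++ (map (_∷ʳ ω) (S k) ++ map (_∷ʳ ω²) (S k))))

G : (k : ℕ) → Vec ℕ (N k) → List (Vec F4 k)
G k m = List.concat (toList (Data.Vec.zipWith (λ mi h → List.replicate mi h) m (S k)))

zeroVec : (k : ℕ) → Vec F4 k
zeroVec k = replicate k 𝟎

dot : {k : ℕ} → Vec F4 k → Vec F4 k → F4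
dot x h = foldr _ _⊕_ 𝟎 (Data.Vec.zipWith _⊗_ x h)

codeword : (k : ℕ) → Vec ℕ (N k) → Vec F4 k → List F4
codeword k m x = List.map (dot x) (G k m)

wt : List F4 → ℕ
wt List.[] = 0
wt (𝟎 List.∷ c) = wt c
wt (_ List.∷ c) = suc (wt c)

-- C_k(m) has dimension k: the generator matrix G_k(m) has full row rank k.
HasDimension : (k : ℕ) → Vec ℕ (N k) → Set
HasDimension k m = (x : Vec F4 k) → ¬ x ≡ zeroVec k →
  ¬ codeword k m x ≡ List.replicate (List.length (G k m)) 𝟎

MinWeightAtLeast : (k : ℕ) → Vec ℕ (N k) → ℕ → Set
MinWeightAtLeast k m α = (x : Vec F4 k) →
  ¬ codeword k m x ≡ List.replicate (List.length (G k m)) 𝟎 →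
  α Data.Nat.≤ wt (codeword k m x)

-- The columns of S_k are pairwise linearly independent, so as x runs over F4^k the
-- value x · h_i is uniformly distributed on F4 and, for i ≠ j, the pair
-- (x · h_i, x · h_j) is uniformly distributed on F4²; both facts follow by
-- induction on k from the recursive shape of S_k. Double counting
-- Σ_x f(x · h_i) wt(x G_k(m)) with these distributions expresses it through m_i
-- and n. For f the indicator of x · h_i ≠ 0 every counted codeword has weight at
-- least α, which gives the lower bound on m_i; for f the indicator of
-- x · h_i = 0 all but the zero codeword do, which gives the upper bound.
module Submission where

open import Defs
open import Data.Nat using (ℕ; _+_; _*_; _∸_; _^_; _≤_)
open import Data.Vec using (Vec; lookup; sum)
open import Data.Fin using (Fin)
open import Data.Product using (_×_)
open import Relation.Binary.PropositionalEquality using (_≡_)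

import Data.Nat as ℕ
open import Data.Nat using (zero; suc; s≤s; NonZero; >-nonZero⁻¹)
open import Data.Nat.Properties hiding (_≟_)
open import Data.Nat.Tactic.RingSolver using (solve-∀)
open import Algebra.Properties.Semiring.Sum +-*-semiring
  using (sum-syntax; sum-cong-≗; sum-remove; *-distribˡ-sum; *-distribʳ-sum)
open import Algebra.Properties.CommutativeSemigroup *-commutativeSemigroup using (x∙yz≈y∙xz)
open import Data.Fin using (zero; suc; _↑ˡ_; _↑ʳ_; splitAt; punchIn)
import Data.Fin.Properties as Fin
open import Data.Fin.Properties using (splitAt⁻¹-↑ˡ; splitAt⁻¹-↑ʳ; punchInᵢ≢i)
import Data.List as List
import Data.List.Properties as LP
open import Data.Product using (_,_; ∃-syntax)
open import Data.Sum using (inj₁; inj₂)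
open import Data.Vec using ([]; _∷_; _∷ʳ_; map; zipWith; replicate; head; toList)
open import Data.Vec.Properties using (lookup-++ˡ; lookup-++ʳ; lookup-map; ≡-dec)
open import Function using (_∘_)
open import Relation.Binary.Definitions using (DecidableEquality)
open import Relation.Binary.PropositionalEquality
  using (_≢_; refl; sym; trans; cong; cong₂; subst; subst₂; module ≡-Reasoning)
open import Relation.Nullary using (Dec; yes; no; contradiction)
open import Relation.Nullary.Decidable using (map′; from-yes; _×-dec_; _→-dec_)

private
  encode : F4 → ℕ
  encode 𝟎  = 0
  encode 𝟏  = 1
  encode ω  = 2
  encode ω² = 3

  decode : ℕ → F4
  decode 0 = 𝟎
  decode 1 = 𝟏
  decode 2 = ω
  decode _ = ω²

  decode-encode : ∀ x → decode (encode x) ≡ x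
  decode-encode 𝟎  = refl
  decode-encode 𝟏  = refl
  decode-encode ω  = refl
  decode-encode ω² = refl

infix 4 _≟_
_≟_ : DecidableEquality F4
x ≟ y = map′ encode-injective (cong encode) (encode x ℕ.≟ encode y)
  where
  encode-injective : encode x ≡ encode y → x ≡ y
  encode-injective e = trans (sym (decode-encode x)) (trans (cong decode e) (decode-encode y))

∀? : {P : F4 → Set} → (∀ x → Dec (P x)) → Dec (∀ x → P x)
∀? P? = map′ (λ (p₀ , p₁ , p₂ , p₃) → λ { 𝟎 → p₀ ; 𝟏 → p₁ ; ω → p₂ ; ω² → p₃ })
             (λ p → p 𝟎 , p 𝟏 , p ω , p ω²)
             (P? 𝟎 ×-dec P? 𝟏 ×-dec P? ω ×-dec P? ω²)

⊕-identityʳ : ∀ x → x ⊕ 𝟎 ≡ x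
⊕-identityʳ = from-yes (∀? λ x → x ⊕ 𝟎 ≟ x)

⊕-comm : ∀ x y → x ⊕ y ≡ y ⊕ x
⊕-comm = from-yes (∀? λ x → ∀? λ y → x ⊕ y ≟ y ⊕ x)

⊕-assoc : ∀ x y z → (x ⊕ y) ⊕ z ≡ x ⊕ (y ⊕ z)
⊕-assoc = from-yes (∀? λ x → ∀? λ y → ∀? λ z → (x ⊕ y) ⊕ z ≟ x ⊕ (y ⊕ z))

⊕≡𝟎⇒≡ : ∀ x y → x ⊕ y ≡ 𝟎 → x ≡ y
⊕≡𝟎⇒≡ = from-yes (∀? λ x → ∀? λ y → (x ⊕ y ≟ 𝟎) →-dec (x ≟ y))

⊗-zeroʳ : ∀ x → x ⊗ 𝟎 ≡ 𝟎
⊗-zeroʳ = from-yes (∀? λ x → x ⊗ 𝟎 ≟ 𝟎)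

⊗-identityʳ : ∀ x → x ⊗ 𝟏 ≡ x
⊗-identityʳ = from-yes (∀? λ x → x ⊗ 𝟏 ≟ x)

shear : ∀ a c t u → (a ⊕ c ⊗ t) ⊕ c ⊗ (t ⊕ u) ≡ a ⊕ c ⊗ u
shear = from-yes (∀? λ a → ∀? λ c → ∀? λ t → ∀? λ u →
  (a ⊕ c ⊗ t) ⊕ c ⊗ (t ⊕ u) ≟ a ⊕ c ⊗ u)

Σ₄ : (F4 → ℕ) → ℕ
Σ₄ f = f 𝟎 + f 𝟏 + f ω + f ω²

Σ₄-cong : ∀ {f g : F4 → ℕ} → (∀ a → f a ≡ g a) → Σ₄ f ≡ Σ₄ g
Σ₄-cong e = cong₂ _+_ (cong₂ _+_ (cong₂ _+_ (e 𝟎) (e 𝟏)) (e ω)) (e ω²)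

Σ₄-mono : ∀ {f g : F4 → ℕ} → (∀ a → f a ≤ g a) → Σ₄ f ≤ Σ₄ g
Σ₄-mono e = +-mono-≤ (+-mono-≤ (+-mono-≤ (e 𝟎) (e 𝟏)) (e ω)) (e ω²)

Σ₄-distrib-+ : ∀ (f g : F4 → ℕ) → Σ₄ (λ a → f a + g a) ≡ Σ₄ f + Σ₄ g
Σ₄-distrib-+ f g = lemma (f 𝟎) (f 𝟏) (f ω) (f ω²) (g 𝟎) (g 𝟏) (g ω) (g ω²)
  where
  lemma : ∀ a b c d p q r s → a + p + (b + q) + (c + r) + (d + s) ≡ a + b + c + d + (p + q + r + s)
  lemma = solve-∀

Σ₄-*ˡ : ∀ K (f : F4 → ℕ) → Σ₄ (λ a → K * f a) ≡ K * Σ₄ f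
Σ₄-*ˡ K f = lemma K (f 𝟎) (f 𝟏) (f ω) (f ω²)
  where
  lemma : ∀ K a b c d → K * a + K * b + K * c + K * d ≡ K * (a + b + c + d)
  lemma = solve-∀

Σ₄-const : ∀ K → Σ₄ (λ _ → K) ≡ 4 * K
Σ₄-const K = lemma K
  where
  lemma : ∀ K → K + K + K + K ≡ 4 * K
  lemma = solve-∀

Σ₄-comm : ∀ (F : F4 → F4 → ℕ) → Σ₄ (λ a → Σ₄ (F a)) ≡ Σ₄ (λ b → Σ₄ (λ a → F a b))
Σ₄-comm F = sym (begin
  Σ₄ (λ b → F 𝟎 b + F 𝟏 b + F ω b + F ω² b)
    ≡⟨ Σ₄-distrib-+ (λ b → F 𝟎 b + F 𝟏 b + F ω b) (F ω²) ⟩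
  Σ₄ (λ b → F 𝟎 b + F 𝟏 b + F ω b) + Σ₄ (F ω²)
    ≡⟨ cong (_+ Σ₄ (F ω²)) (Σ₄-distrib-+ (λ b → F 𝟎 b + F 𝟏 b) (F ω)) ⟩
  Σ₄ (λ b → F 𝟎 b + F 𝟏 b) + Σ₄ (F ω) + Σ₄ (F ω²)
    ≡⟨ cong (λ s → s + Σ₄ (F ω) + Σ₄ (F ω²)) (Σ₄-distrib-+ (F 𝟎) (F 𝟏)) ⟩
  Σ₄ (F 𝟎) + Σ₄ (F 𝟏) + Σ₄ (F ω) + Σ₄ (F ω²)
    ∎)
  where open ≡-Reasoning

Σ₄-product : ∀ (f g : F4 → ℕ) → Σ₄ (λ a → Σ₄ (λ b → f a * g b)) ≡ Σ₄ f * Σ₄ g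
Σ₄-product f g = trans (Σ₄-cong (λ a → Σ₄-*ˡ (f a) g)) (lemma (f 𝟎) (f 𝟏) (f ω) (f ω²) (Σ₄ g))
  where
  lemma : ∀ a b c d s → a * s + b * s + c * s + d * s ≡ (a + b + c + d) * s
  lemma = solve-∀

Σ₄-translate : ∀ (f : F4 → ℕ) d → Σ₄ (λ a → f (a ⊕ d)) ≡ Σ₄ f
Σ₄-translate f 𝟎  = Σ₄-cong (λ a → cong f (⊕-identityʳ a))
Σ₄-translate f 𝟏  = lemma (f 𝟎) (f 𝟏) (f ω) (f ω²)
  where
  lemma : ∀ a b c d → b + a + d + c ≡ a + b + c + d
  lemma = solve-∀
Σ₄-translate f ω  = lemma (f 𝟎) (f 𝟏) (f ω) (f ω²)
  where
  lemma : ∀ a b c d → c + d + a + b ≡ a + b + c + d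
  lemma = solve-∀
Σ₄-translate f ω² = lemma (f 𝟎) (f 𝟏) (f ω) (f ω²)
  where
  lemma : ∀ a b c d → d + c + b + a ≡ a + b + c + d
  lemma = solve-∀

Σ₄-scale : ∀ (f : F4 → ℕ) d → d ≢ 𝟎 → Σ₄ (λ c → f (c ⊗ d)) ≡ Σ₄ f
Σ₄-scale f 𝟎  d≢𝟎 = contradiction refl d≢𝟎
Σ₄-scale f 𝟏  _   = refl
Σ₄-scale f ω  _   = lemma (f 𝟎) (f 𝟏) (f ω) (f ω²)
  where
  lemma : ∀ a b c d → a + c + d + b ≡ a + b + c + d
  lemma = solve-∀
Σ₄-scale f ω² _   = lemma (f 𝟎) (f 𝟏) (f ω) (f ω²)
  where
  lemma : ∀ a b c d → a + d + b + c ≡ a + b + c + d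
  lemma = solve-∀

Σ₄-affine : ∀ (f : F4 → ℕ) a d → d ≢ 𝟎 → Σ₄ (λ c → f (a ⊕ c ⊗ d)) ≡ Σ₄ f
Σ₄-affine f a d d≢𝟎 = begin
  Σ₄ (λ c → f (a ⊕ c ⊗ d))  ≡⟨ Σ₄-scale (λ b → f (a ⊕ b)) d d≢𝟎 ⟩
  Σ₄ (λ b → f (a ⊕ b))      ≡⟨ Σ₄-cong (λ b → cong f (⊕-comm a b)) ⟩
  Σ₄ (λ b → f (b ⊕ a))      ≡⟨ Σ₄-translate f a ⟩
  Σ₄ f                      ∎
  where open ≡-Reasoning

-- The substitution (c, a) ↦ (a ⊕ c t, a ⊕ c u) is invertible when t ≠ u.
Σ₄-shear : ∀ (F : F4 → F4 → ℕ) t u → t ≢ u →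
  Σ₄ (λ c → Σ₄ (λ a → F (a ⊕ c ⊗ t) (a ⊕ c ⊗ u))) ≡ Σ₄ (λ a → Σ₄ (F a))
Σ₄-shear F t u t≢u = begin
  Σ₄ (λ c → Σ₄ (λ a → F (a ⊕ c ⊗ t) (a ⊕ c ⊗ u)))
    ≡⟨ Σ₄-cong (λ c → Σ₄-cong (λ a → cong (F (a ⊕ c ⊗ t)) (sym (shear a c t u)))) ⟩
  Σ₄ (λ c → Σ₄ (λ a → F (a ⊕ c ⊗ t) ((a ⊕ c ⊗ t) ⊕ c ⊗ (t ⊕ u))))
    ≡⟨ Σ₄-cong (λ c → Σ₄-translate (λ b → F b (b ⊕ c ⊗ (t ⊕ u))) (c ⊗ t)) ⟩
  Σ₄ (λ c → Σ₄ (λ a → F a (a ⊕ c ⊗ (t ⊕ u))))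
    ≡⟨ sym (Σ₄-comm (λ a c → F a (a ⊕ c ⊗ (t ⊕ u)))) ⟩
  Σ₄ (λ a → Σ₄ (λ c → F a (a ⊕ c ⊗ (t ⊕ u))))
    ≡⟨ Σ₄-cong (λ a → Σ₄-affine (F a) a (t ⊕ u) (t≢u ∘ ⊕≡𝟎⇒≡ t u)) ⟩
  Σ₄ (λ a → Σ₄ (F a))
    ∎
  where open ≡-Reasoning

ΣV : (k : ℕ) → (Vec F4 k → ℕ) → ℕ
ΣV zero    F = F []
ΣV (suc k) F = Σ₄ λ a → ΣV k (λ x → F (a ∷ x))

ΣV-cong : ∀ k {F G : Vec F4 k → ℕ} → (∀ x → F x ≡ G x) → ΣV k F ≡ ΣV k G
ΣV-cong zero    e = e []
ΣV-cong (suc k) e = Σ₄-cong λ a → ΣV-cong k (λ x → e (a ∷ x))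

ΣV-mono : ∀ k {F G : Vec F4 k → ℕ} → (∀ x → F x ≤ G x) → ΣV k F ≤ ΣV k G
ΣV-mono zero    e = e []
ΣV-mono (suc k) e = Σ₄-mono λ a → ΣV-mono k (λ x → e (a ∷ x))

ΣV-distrib-+ : ∀ k (F G : Vec F4 k → ℕ) → ΣV k (λ x → F x + G x) ≡ ΣV k F + ΣV k G
ΣV-distrib-+ zero    F G = refl
ΣV-distrib-+ (suc k) F G =
  trans (Σ₄-cong λ a → ΣV-distrib-+ k (λ x → F (a ∷ x)) (λ x → G (a ∷ x)))
        (Σ₄-distrib-+ (λ a → ΣV k (λ x → F (a ∷ x))) (λ a → ΣV k (λ x → G (a ∷ x))))

ΣV-*ˡ : ∀ k K (F : Vec F4 k → ℕ) → ΣV k (λ x → K * F x) ≡ K * ΣV k F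
ΣV-*ˡ zero    K F = refl
ΣV-*ˡ (suc k) K F =
  trans (Σ₄-cong λ a → ΣV-*ˡ k K (λ x → F (a ∷ x))) (Σ₄-*ˡ K (λ a → ΣV k (λ x → F (a ∷ x))))

ΣV-const : ∀ k K → ΣV k (λ _ → K) ≡ 4 ^ k * K
ΣV-const zero    K = sym (+-identityʳ K)
ΣV-const (suc k) K =
  trans (Σ₄-cong λ _ → ΣV-const k K) (trans (Σ₄-const (4 ^ k * K)) (sym (*-assoc 4 (4 ^ k) K)))

ΣV-∷ʳ : ∀ k (F : Vec F4 (suc k) → ℕ) → ΣV (suc k) F ≡ Σ₄ (λ c → ΣV k (λ x → F (x ∷ʳ c)))
ΣV-∷ʳ zero    F = refl
ΣV-∷ʳ (suc k) F =
  trans (Σ₄-cong λ a → ΣV-∷ʳ k (λ x → F (a ∷ x)))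
        (Σ₄-comm λ a c → ΣV k (λ x → F (a ∷ (x ∷ʳ c))))

infixl 6 _⊕ᵛ_
_⊕ᵛ_ : ∀ {r} → Vec F4 r → Vec F4 r → Vec F4 r
_⊕ᵛ_ = zipWith _⊕_

ΣV-translate : ∀ r (F : Vec F4 r → ℕ) d → ΣV r (λ y → F (y ⊕ᵛ d)) ≡ ΣV r F
ΣV-translate zero    F []      = refl
ΣV-translate (suc r) F (e ∷ d) =
  trans (Σ₄-cong λ a → ΣV-translate r (λ y → F ((a ⊕ e) ∷ y)) d)
        (Σ₄-translate (λ b → ΣV r (λ y → F (b ∷ y))) e)

dot-∷ʳ : ∀ {k} (x h : Vec F4 k) c t → dot (x ∷ʳ c) (h ∷ʳ t) ≡ dot x h ⊕ c ⊗ t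
dot-∷ʳ []      []      c t = ⊕-identityʳ (c ⊗ t)
dot-∷ʳ (a ∷ x) (b ∷ h) c t =
  trans (cong (a ⊗ b ⊕_) (dot-∷ʳ x h c t)) (sym (⊕-assoc (a ⊗ b) (dot x h) (c ⊗ t)))

dot-zeroˡ : ∀ {k} (h : Vec F4 k) → dot (zeroVec k) h ≡ 𝟎
dot-zeroˡ []      = refl
dot-zeroˡ (b ∷ h) = dot-zeroˡ h

dot-zeroʳ : ∀ {k} (x : Vec F4 k) → dot x (zeroVec k) ≡ 𝟎
dot-zeroʳ []      = refl
dot-zeroʳ (a ∷ x) = cong₂ _⊕_ (⊗-zeroʳ a) (dot-zeroʳ x)

unitVec : (k : ℕ) → Vec F4 (suc k)
unitVec k = replicate k 𝟎 ∷ʳ 𝟏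

dot-unitVec : ∀ {k} (x : Vec F4 k) c → dot (x ∷ʳ c) (unitVec k) ≡ c
dot-unitVec x c = trans (dot-∷ʳ x (zeroVec _) c 𝟏) (cong₂ _⊕_ (dot-zeroʳ x) (⊗-identityʳ c))

map-dot-∷ʳ : ∀ {k r} (hs : Vec (Vec F4 k) r) ts x c →
  map (dot (x ∷ʳ c)) (zipWith _∷ʳ_ hs ts) ≡ map (dot x) hs ⊕ᵛ map (c ⊗_) ts
map-dot-∷ʳ []       []       x c = refl
map-dot-∷ʳ (h ∷ hs) (t ∷ ts) x c = cong₂ _∷_ (dot-∷ʳ x h c t) (map-dot-∷ʳ hs ts x c)

-- As x ranges over F4^k, the vector (x · h)_{h ∈ hs} takes every value in F4^r
-- exactly 4^(k-r) times.
record Balanced (k : ℕ) {r : ℕ} (hs : Vec (Vec F4 k) r) : Set where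
  constructor balanced
  field
    ΣV-map-dot : ∀ F → 4 ^ r * ΣV k (λ x → F (map (dot x) hs)) ≡ 4 ^ k * ΣV r F

open Balanced

Balanced-[] : ∀ k → Balanced k []
Balanced-[] k = balanced λ F → trans (+-identityʳ _) (ΣV-const k (F []))

Balanced-slice : ∀ {k r} {hs : Vec (Vec F4 k) r} → Balanced k hs → ∀ ts c F →
  4 ^ r * ΣV k (λ x → F (map (dot (x ∷ʳ c)) (zipWith _∷ʳ_ hs ts))) ≡ 4 ^ k * ΣV r F
Balanced-slice {k} {r} {hs} bal ts c F = begin
  4 ^ r * ΣV k (λ x → F (map (dot (x ∷ʳ c)) (zipWith _∷ʳ_ hs ts)))
    ≡⟨ cong (4 ^ r *_) (ΣV-cong k λ x → cong F (map-dot-∷ʳ hs ts x c)) ⟩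
  4 ^ r * ΣV k (λ x → F (map (dot x) hs ⊕ᵛ cts))
    ≡⟨ ΣV-map-dot bal (λ y → F (y ⊕ᵛ cts)) ⟩
  4 ^ k * ΣV r (λ y → F (y ⊕ᵛ cts))
    ≡⟨ cong (4 ^ k *_) (ΣV-translate r F cts) ⟩
  4 ^ k * ΣV r F
    ∎
  where
  open ≡-Reasoning
  cts = map (c ⊗_) ts

Balanced-extend : ∀ {k r} {hs : Vec (Vec F4 k) r} → Balanced k hs →
  ∀ ts → Balanced (suc k) (zipWith _∷ʳ_ hs ts)
Balanced-extend {k} {r} {hs} bal ts = balanced λ F →
  let slice : F4 → ℕ
      slice c = ΣV k (λ x → F (map (dot (x ∷ʳ c)) (zipWith _∷ʳ_ hs ts)))
  in begin
  4 ^ r * ΣV (suc k) (λ x → F (map (dot x) (zipWith _∷ʳ_ hs ts)))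
    ≡⟨ cong (4 ^ r *_) (ΣV-∷ʳ k (λ x → F (map (dot x) (zipWith _∷ʳ_ hs ts)))) ⟩
  4 ^ r * Σ₄ slice
    ≡⟨ sym (Σ₄-*ˡ (4 ^ r) slice) ⟩
  Σ₄ (λ c → 4 ^ r * slice c)
    ≡⟨ Σ₄-cong (λ c → Balanced-slice bal ts c F) ⟩
  Σ₄ (λ _ → 4 ^ k * ΣV r F)
    ≡⟨ Σ₄-const (4 ^ k * ΣV r F) ⟩
  4 * (4 ^ k * ΣV r F)
    ≡⟨ sym (*-assoc 4 (4 ^ k) (ΣV r F)) ⟩
  4 ^ suc k * ΣV r F
    ∎
  where open ≡-Reasoning

Balanced-unitVec : ∀ {k r} {hs : Vec (Vec F4 k) r} → Balanced k hs →
  ∀ ts → Balanced (suc k) (unitVec k ∷ zipWith _∷ʳ_ hs ts)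
Balanced-unitVec {k} {r} {hs} bal ts = balanced λ F →
  let slice : F4 → F4 → ℕ
      slice a c = ΣV k (λ x → F (a ∷ map (dot (x ∷ʳ c)) (zipWith _∷ʳ_ hs ts)))
  in begin
  4 ^ suc r * ΣV (suc k) (λ x → F (map (dot x) (unitVec k ∷ zipWith _∷ʳ_ hs ts)))
    ≡⟨ cong (4 ^ suc r *_) (ΣV-∷ʳ k (λ x → F (map (dot x) (unitVec k ∷ zipWith _∷ʳ_ hs ts)))) ⟩
  4 ^ suc r * Σ₄ (λ c → ΣV k (λ x → F (map (dot (x ∷ʳ c)) (unitVec k ∷ zipWith _∷ʳ_ hs ts))))
    ≡⟨ cong (4 ^ suc r *_) (Σ₄-cong λ c → ΣV-cong k λ x →
         cong (λ a → F (a ∷ map (dot (x ∷ʳ c)) (zipWith _∷ʳ_ hs ts))) (dot-unitVec x c)) ⟩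
  4 ^ suc r * Σ₄ (λ c → slice c c)
    ≡⟨ *-assoc 4 (4 ^ r) (Σ₄ (λ c → slice c c)) ⟩
  4 * (4 ^ r * Σ₄ (λ c → slice c c))
    ≡⟨ cong (4 *_) (sym (Σ₄-*ˡ (4 ^ r) (λ c → slice c c))) ⟩
  4 * Σ₄ (λ c → 4 ^ r * slice c c)
    ≡⟨ cong (4 *_) (Σ₄-cong λ c → Balanced-slice bal ts c (λ y → F (c ∷ y))) ⟩
  4 * Σ₄ (λ c → 4 ^ k * ΣV r (λ y → F (c ∷ y)))
    ≡⟨ cong (4 *_) (Σ₄-*ˡ (4 ^ k) (λ c → ΣV r (λ y → F (c ∷ y)))) ⟩
  4 * (4 ^ k * ΣV (suc r) F)
    ≡⟨ sym (*-assoc 4 (4 ^ k) (ΣV (suc r) F)) ⟩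
  4 ^ suc k * ΣV (suc r) F
    ∎
  where open ≡-Reasoning

Balanced-swap : ∀ {k} {h h′ : Vec F4 k} → Balanced k (h ∷ h′ ∷ []) → Balanced k (h′ ∷ h ∷ [])
Balanced-swap {k} bal = balanced λ F →
  trans (ΣV-map-dot bal (λ { (a ∷ b ∷ []) → F (b ∷ a ∷ []) }))
        (cong (4 ^ k *_) (Σ₄-comm λ a b → F (b ∷ a ∷ [])))

Balanced-split : ∀ {k} {h : Vec F4 k} → Balanced k (h ∷ []) →
  ∀ {t u} → t ≢ u → Balanced (suc k) ((h ∷ʳ t) ∷ (h ∷ʳ u) ∷ [])
Balanced-split {k} {h} bal {t} {u} t≢u = balanced λ F →
  let Fₜᵤ : F4 → F4 → ℕ
      Fₜᵤ c a = F ((a ⊕ c ⊗ t) ∷ (a ⊕ c ⊗ u) ∷ [])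
      slice : F4 → ℕ
      slice c = ΣV k (λ x → Fₜᵤ c (dot x h))
  in begin
  16 * ΣV (suc k) (λ x → F (dot x (h ∷ʳ t) ∷ dot x (h ∷ʳ u) ∷ []))
    ≡⟨ cong (16 *_) (ΣV-∷ʳ k (λ x → F (dot x (h ∷ʳ t) ∷ dot x (h ∷ʳ u) ∷ []))) ⟩
  16 * Σ₄ (λ c → ΣV k (λ x → F (dot (x ∷ʳ c) (h ∷ʳ t) ∷ dot (x ∷ʳ c) (h ∷ʳ u) ∷ [])))
    ≡⟨ cong (16 *_) (Σ₄-cong λ c → ΣV-cong k λ x →
         cong₂ (λ a b → F (a ∷ b ∷ [])) (dot-∷ʳ x h c t) (dot-∷ʳ x h c u)) ⟩
  16 * Σ₄ slice
    ≡⟨ *-assoc 4 4 (Σ₄ slice) ⟩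
  4 * (4 * Σ₄ slice)
    ≡⟨ cong (4 *_) (sym (Σ₄-*ˡ 4 slice)) ⟩
  4 * Σ₄ (λ c → 4 * slice c)
    ≡⟨ cong (4 *_) (Σ₄-cong λ c → ΣV-map-dot bal (λ y → Fₜᵤ c (head y))) ⟩
  4 * Σ₄ (λ c → 4 ^ k * Σ₄ (Fₜᵤ c))
    ≡⟨ cong (4 *_) (Σ₄-*ˡ (4 ^ k) (λ c → Σ₄ (Fₜᵤ c))) ⟩
  4 * (4 ^ k * Σ₄ (λ c → Σ₄ (Fₜᵤ c)))
    ≡⟨ sym (*-assoc 4 (4 ^ k) (Σ₄ (λ c → Σ₄ (Fₜᵤ c)))) ⟩
  4 ^ suc k * Σ₄ (λ c → Σ₄ (Fₜᵤ c))
    ≡⟨ cong (4 ^ suc k *_) (Σ₄-shear (λ a b → F (a ∷ b ∷ [])) t u t≢u) ⟩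
  4 ^ suc k * ΣV 2 F
    ∎
  where open ≡-Reasoning

data Column (k : ℕ) : Set where
  lifted : Fin (N k) → F4 → Column k
  unit   : Column k

column : ∀ k → Column k → Vec F4 (suc k)
column k (lifted p t) = lookup (S k) p ∷ʳ t
column k unit         = unitVec k

position : ∀ k → Column k → Fin (N (suc k))
position k (lifted p 𝟎)  = p ↑ˡ (1 + (N k + (N k + N k)))
position k unit          = N k ↑ʳ zero
position k (lifted p 𝟏)  = N k ↑ʳ suc (p ↑ˡ (N k + N k))
position k (lifted p ω)  = N k ↑ʳ suc (N k ↑ʳ (p ↑ˡ N k))
position k (lifted p ω²) = N k ↑ʳ suc (N k ↑ʳ (N k ↑ʳ p))

lookup-position : ∀ k c → lookup (S (suc k)) (position k c) ≡ column k c
lookup-position k (lifted p 𝟎) =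
  trans (lookup-++ˡ (map (_∷ʳ 𝟎) (S k)) _ p) (lookup-map p (_∷ʳ 𝟎) (S k))
lookup-position k unit = lookup-++ʳ (map (_∷ʳ 𝟎) (S k)) _ zero
lookup-position k (lifted p 𝟏) =
  trans (lookup-++ʳ (map (_∷ʳ 𝟎) (S k)) _ (suc (p ↑ˡ (N k + N k))))
  (trans (lookup-++ˡ (map (_∷ʳ 𝟏) (S k)) _ p) (lookup-map p (_∷ʳ 𝟏) (S k)))
lookup-position k (lifted p ω) =
  trans (lookup-++ʳ (map (_∷ʳ 𝟎) (S k)) _ (suc (N k ↑ʳ (p ↑ˡ N k))))
  (trans (lookup-++ʳ (map (_∷ʳ 𝟏) (S k)) _ (p ↑ˡ N k))
  (trans (lookup-++ˡ (map (_∷ʳ ω) (S k)) _ p) (lookup-map p (_∷ʳ ω) (S k))))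
lookup-position k (lifted p ω²) =
  trans (lookup-++ʳ (map (_∷ʳ 𝟎) (S k)) _ (suc (N k ↑ʳ (N k ↑ʳ p))))
  (trans (lookup-++ʳ (map (_∷ʳ 𝟏) (S k)) _ (N k ↑ʳ p))
  (trans (lookup-++ʳ (map (_∷ʳ ω) (S k)) _ p) (lookup-map p (_∷ʳ ω²) (S k))))

position-surjective : ∀ k (i : Fin (N (suc k))) → ∃[ c ] position k c ≡ i
position-surjective k i with splitAt (N k) i in eq₀
... | inj₁ p = lifted p 𝟎 , splitAt⁻¹-↑ˡ eq₀
... | inj₂ zero = unit , splitAt⁻¹-↑ʳ eq₀
... | inj₂ (suc j) with splitAt (N k) j in eq₁
...   | inj₁ p = lifted p 𝟏 ,
  trans (cong (λ z → N k ↑ʳ suc z) (splitAt⁻¹-↑ˡ eq₁)) (splitAt⁻¹-↑ʳ eq₀)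
...   | inj₂ j′ with splitAt (N k) j′ in eq₂
...     | inj₁ p = lifted p ω ,
  trans (cong (λ z → N k ↑ʳ suc (N k ↑ʳ z)) (splitAt⁻¹-↑ˡ eq₂))
        (trans (cong (λ z → N k ↑ʳ suc z) (splitAt⁻¹-↑ʳ eq₁)) (splitAt⁻¹-↑ʳ eq₀))
...     | inj₂ p = lifted p ω² ,
  trans (cong (λ z → N k ↑ʳ suc (N k ↑ʳ z)) (splitAt⁻¹-↑ʳ eq₂))
        (trans (cong (λ z → N k ↑ʳ suc z) (splitAt⁻¹-↑ʳ eq₁)) (splitAt⁻¹-↑ʳ eq₀))

column-balanced : ∀ k (i : Fin (N k)) → Balanced k (lookup (S k) i ∷ [])
column-balanced (suc k) i with position-surjective k i
... | c , refl = subst (λ h → Balanced (suc k) (h ∷ [])) (sym (lookup-position k c)) (balanced-at c)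
  where
  balanced-at : ∀ c → Balanced (suc k) (column k c ∷ [])
  balanced-at (lifted p t) = Balanced-extend (column-balanced k p) (t ∷ [])
  balanced-at unit         = Balanced-unitVec (Balanced-[] k) []

column-pair-balanced : ∀ k (i j : Fin (N k)) → i ≢ j →
  Balanced k (lookup (S k) i ∷ lookup (S k) j ∷ [])
column-pair-balanced (suc k) i j i≢j with position-surjective k i | position-surjective k j
... | c , refl | d , refl =
  subst₂ (λ h h′ → Balanced (suc k) (h ∷ h′ ∷ []))
         (sym (lookup-position k c)) (sym (lookup-position k d))
    (balanced-at-pair c d (i≢j ∘ cong (position k)))
  where
  balanced-at-pair : ∀ c d → c ≢ d → Balanced (suc k) (column k c ∷ column k d ∷ [])
  balanced-at-pair (lifted p t) (lifted q u) c≢d with p Fin.≟ q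
  ... | yes refl = Balanced-split (column-balanced k p) (c≢d ∘ cong (lifted p))
  ... | no p≢q   = Balanced-extend (column-pair-balanced k p q p≢q) (t ∷ u ∷ [])
  balanced-at-pair unit (lifted p t) _ = Balanced-unitVec (column-balanced k p) (t ∷ [])
  balanced-at-pair (lifted p t) unit _ = Balanced-swap (Balanced-unitVec (column-balanced k p) (t ∷ []))
  balanced-at-pair unit unit c≢d = contradiction refl c≢d

χ≢𝟎 : F4 → ℕ
χ≢𝟎 𝟎 = 0
χ≢𝟎 _ = 1

χ≡𝟎 : F4 → ℕ
χ≡𝟎 𝟎 = 1
χ≡𝟎 _ = 0

χ≡𝟎ᵛ : ∀ {k} → Vec F4 k → ℕ
χ≡𝟎ᵛ []      = 1
χ≡𝟎ᵛ (a ∷ x) = χ≡𝟎 a * χ≡𝟎ᵛ x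

χ≡𝟎ᵛ-zeroVec : ∀ k → χ≡𝟎ᵛ (zeroVec k) ≡ 1
χ≡𝟎ᵛ-zeroVec zero    = refl
χ≡𝟎ᵛ-zeroVec (suc k) = trans (+-identityʳ _) (χ≡𝟎ᵛ-zeroVec k)

ΣV-χ≡𝟎ᵛ : ∀ k → ΣV k χ≡𝟎ᵛ ≡ 1
ΣV-χ≡𝟎ᵛ zero    = refl
ΣV-χ≡𝟎ᵛ (suc k) =
  Σ₄-cong λ a → trans (ΣV-*ˡ k (χ≡𝟎 a) χ≡𝟎ᵛ) (cong (χ≡𝟎 a *_) (ΣV-χ≡𝟎ᵛ k))

wt-∷ : ∀ a c → wt (a List.∷ c) ≡ χ≢𝟎 a + wt c
wt-∷ 𝟎  c = refl
wt-∷ 𝟏  c = refl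
wt-∷ ω  c = refl
wt-∷ ω² c = refl

wt-++ : ∀ xs ys → wt (xs List.++ ys) ≡ wt xs + wt ys
wt-++ List.[]       ys = refl
wt-++ (a List.∷ xs) ys = begin
  wt (a List.∷ (xs List.++ ys))  ≡⟨ wt-∷ a (xs List.++ ys) ⟩
  χ≢𝟎 a + wt (xs List.++ ys)     ≡⟨ cong (χ≢𝟎 a +_) (wt-++ xs ys) ⟩
  χ≢𝟎 a + (wt xs + wt ys)        ≡⟨ sym (+-assoc (χ≢𝟎 a) (wt xs) (wt ys)) ⟩
  χ≢𝟎 a + wt xs + wt ys          ≡⟨ cong (_+ wt ys) (sym (wt-∷ a xs)) ⟩
  wt (a List.∷ xs) + wt ys       ∎
  where open ≡-Reasoning

wt-replicate : ∀ r a → wt (List.replicate r a) ≡ r * χ≢𝟎 a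
wt-replicate zero    a = refl
wt-replicate (suc r) a = trans (wt-∷ a (List.replicate r a)) (cong (χ≢𝟎 a +_) (wt-replicate r a))

wt-codeword : ∀ {k n} (x : Vec F4 k) (m : Vec ℕ n) (hs : Vec (Vec F4 k) n) →
  wt (List.map (dot x) (List.concat (toList (zipWith (λ mi h → List.replicate mi h) m hs))))
    ≡ ∑[ j < n ] (lookup m j * χ≢𝟎 (dot x (lookup hs j)))
wt-codeword x []      []       = refl
wt-codeword {n = suc n} x (r ∷ m) (h ∷ hs) = begin
  wt (List.map (dot x) (List.replicate r h List.++ rest))
    ≡⟨ cong wt (LP.map-++ (dot x) (List.replicate r h) rest) ⟩
  wt (List.map (dot x) (List.replicate r h) List.++ List.map (dot x) rest)
    ≡⟨ wt-++ (List.map (dot x) (List.replicate r h)) (List.map (dot x) rest) ⟩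
  wt (List.map (dot x) (List.replicate r h)) + wt (List.map (dot x) rest)
    ≡⟨ cong₂ _+_ (trans (cong wt (LP.map-replicate (dot x) r h)) (wt-replicate r (dot x h)))
                 (wt-codeword x m hs) ⟩
  r * χ≢𝟎 (dot x h) + ∑[ j < n ] (lookup m j * χ≢𝟎 (dot x (lookup hs j)))
    ∎
  where
  open ≡-Reasoning
  rest = List.concat (toList (zipWith (λ mi h → List.replicate mi h) m hs))

∑-lookup : ∀ {n} (m : Vec ℕ n) → ∑[ j < n ] lookup m j ≡ sum m
∑-lookup []      = refl
∑-lookup (r ∷ m) = cong (r +_) (∑-lookup m)

ΣV-∑ : ∀ k {n} (F : Vec F4 k → Fin n → ℕ) →
  ΣV k (λ x → ∑[ j < n ] F x j) ≡ ∑[ j < n ] ΣV k (λ x → F x j)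
ΣV-∑ k {zero}  F = trans (ΣV-const k 0) (*-zeroʳ (4 ^ k))
ΣV-∑ k {suc n} F =
  trans (ΣV-distrib-+ k (λ x → F x zero) (λ x → ∑[ j < n ] F x (suc j)))
        (cong (ΣV k (λ x → F x zero) +_) (ΣV-∑ k (λ x j → F x (suc j))))

ΣV-*-∑ : ∀ k {n} c (F : Vec F4 k → ℕ) (w : Fin n → ℕ) (G : Vec F4 k → Fin n → ℕ) →
  c * ΣV k (λ x → F x * ∑[ j < n ] (w j * G x j)) ≡ ∑[ j < n ] (w j * (c * ΣV k (λ x → F x * G x j)))
ΣV-*-∑ k {n} c F w G = begin
  c * ΣV k (λ x → F x * ∑[ j < n ] (w j * G x j))
    ≡⟨ cong (c *_) (ΣV-cong k λ x → trans (*-distribˡ-sum (F x) (λ j → w j * G x j))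
                                          (sum-cong-≗ λ j → x∙yz≈y∙xz (F x) (w j) (G x j))) ⟩
  c * ΣV k (λ x → ∑[ j < n ] (w j * (F x * G x j)))
    ≡⟨ cong (c *_) (ΣV-∑ k λ x j → w j * (F x * G x j)) ⟩
  c * ∑[ j < n ] ΣV k (λ x → w j * (F x * G x j))
    ≡⟨ cong (c *_) (sum-cong-≗ λ j → ΣV-*ˡ k (w j) (λ x → F x * G x j)) ⟩
  c * ∑[ j < n ] (w j * ΣV k (λ x → F x * G x j))
    ≡⟨ *-distribˡ-sum c (λ j → w j * ΣV k (λ x → F x * G x j)) ⟩
  ∑[ j < n ] (c * (w j * ΣV k (λ x → F x * G x j)))
    ≡⟨ sum-cong-≗ (λ j → x∙yz≈y∙xz c (w j) (ΣV k (λ x → F x * G x j))) ⟩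
  ∑[ j < n ] (w j * (c * ΣV k (λ x → F x * G x j)))
    ∎
  where open ≡-Reasoning

∑-*-except : ∀ {n} (w t : Fin n → ℕ) i B → (∀ j → j ≢ i → t j ≡ B) →
  ∑[ j < n ] (w j * t j) + w i * B ≡ B * ∑[ j < n ] w j + w i * t i
∑-*-except {suc n} w t i B t≡B = begin
  ∑[ j < suc n ] (w j * t j) + w i * B
    ≡⟨ cong (_+ w i * B) (sum-remove {i = i} (λ j → w j * t j)) ⟩
  w i * t i + ∑[ j < n ] (w (punchIn i j) * t (punchIn i j)) + w i * B
    ≡⟨ cong (λ s → w i * t i + s + w i * B)
         (sum-cong-≗ λ j → cong (w (punchIn i j) *_) (t≡B (punchIn i j) (punchInᵢ≢i i j))) ⟩
  w i * t i + ∑[ j < n ] (w (punchIn i j) * B) + w i * B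
    ≡⟨ cong (λ s → w i * t i + s + w i * B) (sym (*-distribʳ-sum B (λ j → w (punchIn i j)))) ⟩
  w i * t i + ∑[ j < n ] w (punchIn i j) * B + w i * B
    ≡⟨ lemma (w i) (t i) B (∑[ j < n ] w (punchIn i j)) ⟩
  B * (w i + ∑[ j < n ] w (punchIn i j)) + w i * t i
    ≡⟨ cong (λ s → B * s + w i * t i) (sym (sum-remove {i = i} w)) ⟩
  B * ∑[ j < suc n ] w j + w i * t i
    ∎
  where
  open ≡-Reasoning
  lemma : ∀ a b B s → a * b + s * B + a * B ≡ B * (a + s) + a * b
  lemma = solve-∀

column-moment : ∀ k (m : Vec ℕ (N k)) (i : Fin (N k)) (f g : F4 → ℕ) →
  16 * ΣV k (λ x → f (dot x (lookup (S k) i)) * ∑[ j < N k ] (lookup m j * g (dot x (lookup (S k) j))))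
    + lookup m i * (4 ^ k * (Σ₄ f * Σ₄ g))
  ≡ 4 ^ k * (Σ₄ f * Σ₄ g) * ∑[ j < N k ] lookup m j
    + lookup m i * (4 * (4 ^ k * Σ₄ (λ a → f a * g a)))
column-moment k m i f g = begin
  16 * ΣV k (λ x → f (xh i x) * ∑[ j < N k ] (lookup m j * g (xh j x))) + lookup m i * B
    ≡⟨ cong (_+ lookup m i * B) (ΣV-*-∑ k 16 (λ x → f (xh i x)) (lookup m) (λ x j → g (xh j x))) ⟩
  ∑[ j < N k ] (lookup m j * t j) + lookup m i * B
    ≡⟨ ∑-*-except (lookup m) t i B t≡B ⟩
  B * ∑[ j < N k ] lookup m j + lookup m i * t i
    ≡⟨ cong (λ s → B * ∑[ j < N k ] lookup m j + lookup m i * s) t-diagonal ⟩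
  B * ∑[ j < N k ] lookup m j + lookup m i * (4 * (4 ^ k * Σ₄ (λ a → f a * g a)))
    ∎
  where
  open ≡-Reasoning
  xh : Fin (N k) → Vec F4 k → F4
  xh j x = dot x (lookup (S k) j)
  B = 4 ^ k * (Σ₄ f * Σ₄ g)
  t : Fin (N k) → ℕ
  t j = 16 * ΣV k (λ x → f (xh i x) * g (xh j x))
  t≡B : ∀ j → j ≢ i → t j ≡ B
  t≡B j j≢i = trans (ΣV-map-dot (column-pair-balanced k i j (j≢i ∘ sym))
                                λ { (a ∷ b ∷ []) → f a * g b })
                    (cong (4 ^ k *_) (Σ₄-product f g))
  t-diagonal : t i ≡ 4 * (4 ^ k * Σ₄ (λ a → f a * g a))
  t-diagonal = trans (*-assoc 4 4 (ΣV k (λ x → f (xh i x) * g (xh i x))))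
                     (cong (4 *_) (ΣV-map-dot (column-balanced k i) λ y → f (head y) * g (head y)))

weight-lower-bound : ∀ k (m : Vec ℕ (N k)) {α} → HasDimension k m → MinWeightAtLeast k m α →
  (F : Vec F4 k → ℕ) →
  α * ΣV k F ≤ ΣV k (λ x → F x * wt (codeword k m x)) + α * F (zeroVec k)
weight-lower-bound k m {α} dim minWt F = begin
  α * ΣV k F
    ≡⟨ sym (ΣV-*ˡ k α F) ⟩
  ΣV k (λ x → α * F x)
    ≤⟨ ΣV-mono k pointwise ⟩
  ΣV k (λ x → F x * W x + α * F (zeroVec k) * χ≡𝟎ᵛ x)
    ≡⟨ ΣV-distrib-+ k (λ x → F x * W x) (λ x → α * F (zeroVec k) * χ≡𝟎ᵛ x) ⟩
  ΣV k (λ x → F x * W x) + ΣV k (λ x → α * F (zeroVec k) * χ≡𝟎ᵛ x)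
    ≡⟨ cong (ΣV k (λ x → F x * W x) +_) (trans (ΣV-*ˡ k (α * F (zeroVec k)) χ≡𝟎ᵛ)
         (trans (cong (α * F (zeroVec k) *_) (ΣV-χ≡𝟎ᵛ k)) (*-identityʳ _))) ⟩
  ΣV k (λ x → F x * W x) + α * F (zeroVec k)
    ∎
  where
  open ≤-Reasoning
  W : Vec F4 k → ℕ
  W x = wt (codeword k m x)
  pointwise : ∀ x → α * F x ≤ F x * W x + α * F (zeroVec k) * χ≡𝟎ᵛ x
  pointwise x with ≡-dec _≟_ x (zeroVec k)
  ... | yes refl = ≤-trans (≤-reflexive (trans (sym (*-identityʳ _))
                                              (cong (α * F x *_) (sym (χ≡𝟎ᵛ-zeroVec k)))))
                           (m≤n+m _ _)
  ... | no x≢𝟎   = ≤-trans (≤-reflexive (*-comm α (F x)))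
                           (≤-trans (*-monoʳ-≤ (F x) (minWt x (dim x x≢𝟎))) (m≤m+n _ _))

column-weight-inequality : ∀ k (m : Vec ℕ (N k)) {n α} →
  sum m ≡ n → HasDimension k m → MinWeightAtLeast k m α → ∀ i (f : F4 → ℕ) →
  4 * α * (4 ^ k * Σ₄ f) + lookup m i * (4 ^ k * (Σ₄ f * 3))
    ≤ 4 ^ k * (Σ₄ f * 3) * n + lookup m i * (4 * (4 ^ k * Σ₄ (λ a → f a * χ≢𝟎 a)))
      + 16 * (α * f 𝟎)
column-weight-inequality k m {n} {α} Σm≡n dim minWt i f = begin
  4 * α * (4 ^ k * Σ₄ f) + mᵢ * B
    ≡⟨ cong (λ s → 4 * α * s + mᵢ * B) (sym (ΣV-map-dot (column-balanced k i) (f ∘ head))) ⟩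
  4 * α * (4 * ΣV k fh) + mᵢ * B
    ≡⟨ cong (_+ mᵢ * B) (reassoc α (ΣV k fh)) ⟩
  16 * (α * ΣV k fh) + mᵢ * B
    ≤⟨ +-monoˡ-≤ (mᵢ * B) (*-monoʳ-≤ 16 (weight-lower-bound k m dim minWt fh)) ⟩
  16 * (T + α * f (dot (zeroVec k) h)) + mᵢ * B
    ≡⟨ cong (λ a → 16 * (T + α * f a) + mᵢ * B) (dot-zeroˡ h) ⟩
  16 * (T + α * f 𝟎) + mᵢ * B
    ≡⟨ regroup T (α * f 𝟎) (mᵢ * B) ⟩
  16 * T + mᵢ * B + 16 * (α * f 𝟎)
    ≡⟨ cong (_+ 16 * (α * f 𝟎)) moment ⟩
  B * n + mᵢ * D + 16 * (α * f 𝟎)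
    ∎
  where
  open ≤-Reasoning
  h = lookup (S k) i
  mᵢ = lookup m i
  B = 4 ^ k * (Σ₄ f * 3)
  D = 4 * (4 ^ k * Σ₄ (λ a → f a * χ≢𝟎 a))
  fh : Vec F4 k → ℕ
  fh x = f (dot x h)
  T = ΣV k (λ x → fh x * wt (codeword k m x))
  reassoc : ∀ a s → 4 * a * (4 * s) ≡ 16 * (a * s)
  reassoc = solve-∀
  regroup : ∀ t c d → 16 * (t + c) + d ≡ 16 * t + d + 16 * c
  regroup = solve-∀
  moment : 16 * T + mᵢ * B ≡ B * n + mᵢ * D
  moment = begin-equality
    16 * T + mᵢ * B
      ≡⟨ cong (λ s → 16 * s + mᵢ * B) (ΣV-cong k λ x → cong (fh x *_) (wt-codeword x m (S k))) ⟩
    16 * ΣV k (λ x → fh x * ∑[ j < N k ] (lookup m j * χ≢𝟎 (dot x (lookup (S k) j)))) + mᵢ * B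
      ≡⟨ column-moment k m i f χ≢𝟎 ⟩
    B * ∑[ j < N k ] lookup m j + mᵢ * D
      ≡⟨ cong (λ s → B * s + mᵢ * D) (trans (∑-lookup m) Σm≡n) ⟩
    B * n + mᵢ * D
      ∎

-- The hypotheses are column-weight-inequality at f = χ≢𝟎 and f = χ≡𝟎 (with 4^k = 16 Q),
-- after evaluating the sums Σ₄.
lower-bound-arithmetic : ∀ K .{{_ : NonZero K}} m n α →
  4 * α * (K * 3) + m * (K * (3 * 3)) ≤ K * (3 * 3) * n + m * (4 * (K * 3)) + 16 * (α * 0) →
  4 * α ≤ m + 3 * n
lower-bound-arithmetic K m n α ineq =
  +-cancelʳ-≤ (3 * m) (4 * α) (m + 3 * n)
    (*-cancelˡ-≤ (3 * K) {{m*n≢0 3 K}} (subst₂ _≤_ (lhs K m α) (rhs K m n α) ineq))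
  where
  lhs : ∀ K m α → 4 * α * (K * 3) + m * (K * (3 * 3)) ≡ 3 * K * (4 * α + 3 * m)
  lhs = solve-∀
  rhs : ∀ K m n α → K * (3 * 3) * n + m * (4 * (K * 3)) + 16 * (α * 0) ≡ 3 * K * (m + 3 * n + 3 * m)
  rhs = solve-∀

upper-bound-arithmetic : ∀ Q .{{_ : NonZero Q}} m n α →
  4 * α * (4 * (4 * Q) * 1) + m * (4 * (4 * Q) * (1 * 3))
    ≤ 4 * (4 * Q) * (1 * 3) * n + m * (4 * (4 * (4 * Q) * 0)) + 16 * (α * 1) →
  3 * Q * m + (4 * Q ∸ 1) * α ≤ 3 * Q * n
upper-bound-arithmetic Q m n α ineq =
  +-cancelʳ-≤ α (3 * Q * m + (4 * Q ∸ 1) * α) (3 * Q * n)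
    (subst (_≤ 3 * Q * n + α) (split-4Q (4 * Q ∸ 1) (m∸n+n≡m (>-nonZero⁻¹ (4 * Q) {{m*n≢0 4 Q}})))
      (*-cancelˡ-≤ 16 (subst₂ _≤_ (lhs Q m α) (rhs Q m n α) ineq)))
  where
  lhs : ∀ Q m α → 4 * α * (4 * (4 * Q) * 1) + m * (4 * (4 * Q) * (1 * 3)) ≡ 16 * (3 * Q * m + 4 * Q * α)
  lhs = solve-∀
  rhs : ∀ Q m n α →
    4 * (4 * Q) * (1 * 3) * n + m * (4 * (4 * (4 * Q) * 0)) + 16 * (α * 1) ≡ 16 * (3 * Q * n + α)
  rhs = solve-∀
  split-4Q : ∀ P → P + 1 ≡ 4 * Q → 3 * Q * m + 4 * Q * α ≡ 3 * Q * m + P * α + α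
  split-4Q P e = trans (cong (λ z → 3 * Q * m + z * α) (sym e)) (lemma (3 * Q * m) P α)
    where
    lemma : ∀ a P α → a + (P + 1) * α ≡ a + P * α + α
    lemma = solve-∀

-- The argument needs only k ≥ 2.
lemma3p2 : (k : ℕ) → 3 ≤ k → (m : Vec ℕ (N k)) → (n α : ℕ) → sum m ≡ n →
    HasDimension k m → MinWeightAtLeast k m α → (i : Fin (N k)) →
      (4 * α ≤ lookup m i + 3 * n)
      × (3 * 4 ^ (k ∸ 2) * lookup m i + (4 ^ (k ∸ 1) ∸ 1) * α ≤ 3 * 4 ^ (k ∸ 2) * n)
lemma3p2 k@(suc (suc q)) (s≤s (s≤s _)) m n α Σm≡n dim minWt i =
    lower-bound-arithmetic (4 ^ k) {{m^n≢0 4 k}} (lookup m i) n α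
      (column-weight-inequality k m Σm≡n dim minWt i χ≢𝟎)
  , upper-bound-arithmetic (4 ^ q) {{m^n≢0 4 q}} (lookup m i) n α
      (column-weight-inequality k m Σm≡n dim minWt i χ≡𝟎)
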